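{- Let $V$ be a finite set, let $\mathcal{C}\subseteq 2^V$ be a nontrivial Sperner hypergraph, and let $h=\Phi_{\mathcal{C}}$ be the hypergraph Horn function represented by the circular CNF of $\mathcal{C}$. Then the following are equivalent: (i) $\mathcal{C}$ satisfies the circuit axiom (C3): if $C_1,C_2\in\mathcal{C}$ are distinct and $u\in C_1\cap C_2$, then there exists $C_3\in\mathcal{C}$ with $C_3\subseteq (C_1\cup C_2)\setminus\{u\}$; (ii) $\mathcal{K}(h)=\mathcal{C}^{dc}$; (iii) $\mathcal{M}(h)=\mathcal{C}^{dcdc}$; (iv) $\mathcal{T}(h)=\left(\mathcal{C}^{dcdc}\right)^{\cap}$.
   Context: Boolean functions $f:\{0,1\}^V\to\{0,1\}$ are viewed as functions on subsets of $V$ via characteristic vectors; $\mathcal{T}(f)$ is the family of true sets ($f(Z)=1$). For $B\subseteq V$ and $v\in V\setminus B$, the definite Horn clause (implication) $B\to v$ is the function whose true sets are exactly the $T\subseteq V$ with $B\not\subseteq T$ or $B\cup\{v\}\subseteq T$. A definite Horn function is a conjunction of such clauses; its true sets are closed under intersection and contain $V$, and $\mathbb{T}_h(Z)$ denotes the smallest true set of $h$ containing $Z$. For a hypergraph $\mathcal{H}\subseteq 2^V$, the circular CNF is $\Phi_{\mathcal{H}}=\bigwedge_{H\in\mathcal{H}}\bigwedge_{v\in H}\big((H\setminus\{v\})\to v\big)$. $\mathcal{K}(h)$ is the family of inclusion-minimal sets $K$ with $\mathbb{T}_h(K)=V$ (minimal keys); $\mathcal{M}(h)$ is the family of inclusion-maximal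 true sets of $h$ different from $V$. For a hypergraph $\mathcal{H}$: $\mathcal{H}^c=\{V\setminus H: H\in\mathcal{H}\}$; $\mathcal{H}^d$ is the family of inclusion-minimal transversals (sets meeting every hyperedge) of $\mathcal{H}$; operators are composed left to right, e.g. $\mathcal{H}^{dc}=(\mathcal{H}^d)^c$, $\mathcal{H}^{dcdc}=(((\mathcal{H}^d)^c)^d)^c$; $\mathcal{H}^\cap$ is the family of all intersections of subfamilies of $\mathcal{H}$, the intersection of the empty subfamily being $V$. A hypergraph is Sperner if no hyperedge contains another distinct hyperedge; nontrivial means here that $\mathcal{C}$ is nonempty and $\emptyset\notin\mathcal{C}$. -}

module Defs where

open import Data.Nat using (ℕ)
open import Data.Fin using (Fin)
open import Data.Fin.Subset public
  using (Subset; _∈_; _⊆_; _∩_; _∪_; _-_; ∁; ⊤; ⊥; ⋂)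
open import Data.List using (List; [])
open import Data.List.Relation.Unary.All using (All)
open import Data.List.Membership.Propositional public
  renaming (_∈_ to _∈ᴸ_; _∉_ to _∉ᴸ_)
open import Data.Product using (Σ; ∃; ∃-syntax; _×_; _,_)
open import Relation.Binary.PropositionalEquality using (_≡_; _≢_)
open import Relation.Nullary using (¬_)

private variable n : ℕ

-- The ground set V is Fin n; subsets of V are 'Subset n'.
-- A hypergraph (family of subsets of V) is a predicate on subsets.
Family : ℕ → Set₁
Family n = Subset n → Set

listFam : List (Subset n) → Family n
listFam 𝓒 X = X ∈ᴸ 𝓒

_≐_ : Family n → Family n → Set
𝓐 ≐ 𝓑 = ∀ X → (𝓐 X → 𝓑 X) × (𝓑 X → 𝓐 X)

Sperner : Family n → Set
Sperner 𝓗 = ∀ A B → 𝓗 A → 𝓗 B → A ⊆ B → A ≡ B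

Nontrivial : Family n → Set
Nontrivial 𝓗 = (∃[ H ] 𝓗 H) × ¬ 𝓗 ⊥

_ᶜ : Family n → Family n
(𝓗 ᶜ) X = 𝓗 (∁ X)

Transversal : Family n → Subset n → Set
Transversal 𝓗 X = ∀ H → 𝓗 H → ∃[ x ] (x ∈ X × x ∈ H)

_ᵈ : Family n → Family n
(𝓗 ᵈ) X = Transversal 𝓗 X × (∀ Y → Y ⊆ X → Transversal 𝓗 Y → X ⊆ Y)

-- 𝓗^∩ : intersections of (finite) subfamilies; empty intersection = V
_^∩ : Family n → Family n
(𝓗 ^∩) X = ∃[ L ] (All 𝓗 L × X ≡ ⋂ L)

CircuitAxiom : Family n → Set
CircuitAxiom 𝓒 = ∀ C₁ C₂ → 𝓒 C₁ → 𝓒 C₂ → C₁ ≢ C₂ →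
  ∀ u → u ∈ C₁ → u ∈ C₂ → ∃[ C₃ ] (𝓒 C₃ × C₃ ⊆ ((C₁ ∪ C₂) - u))

-- The hypergraph Horn function h = Φ_𝓗 (circular CNF), via its true sets

SatClause : Subset n → Fin n → Subset n → Set
SatClause B v T = B ⊆ T → v ∈ T

TrueSet : Family n → Family n
TrueSet 𝓗 T = ∀ H → 𝓗 H → ∀ v → v ∈ H → SatClause (H - v) v T

-- v ∈ 𝕋_h(Z): v lies in the smallest true set containing Z,
-- i.e. in every true set containing Z
InClosure : Family n → Subset n → Fin n → Set
InClosure 𝓗 Z v = ∀ T → TrueSet 𝓗 T → Z ⊆ T → v ∈ T

IsKey : Family n → Subset n → Set
IsKey 𝓗 K = ∀ v → InClosure 𝓗 K v

MinKeys : Family n → Family n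
MinKeys 𝓗 K = IsKey 𝓗 K × (∀ K′ → K′ ⊆ K → IsKey 𝓗 K′ → K ⊆ K′)

MaxTrue : Family n → Family n
MaxTrue 𝓗 T = TrueSet 𝓗 T × T ≢ ⊤ ×
  (∀ T′ → TrueSet 𝓗 T′ → T′ ≢ ⊤ → T ⊆ T′ → T′ ⊆ T)

-- Under (C3) the hyperedges of 𝓒 are the circuits of a matroid. The decisive consequence of
-- (C3), obtained through strong circuit elimination, is that the span of an independent set is a
-- true set of h. From this, keys are exactly the sets containing a basis, so the minimal keys are
-- the bases, i.e. the complements of minimal transversals of 𝓒; the maximal true sets other than
-- V are the hyperplanes (maximal sets containing no basis), i.e. 𝓒^{dcdc}; and every true set is
-- an intersection of hyperplanes, since a true set T and a point z ∉ T are separated by the span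
-- of B - z for a basis B extending an independent I ⊆ T spanning T, with I ∪ {z} ⊆ B.
-- Conversely, if (C3) fails for C₁, C₂, u, then (C₁ ∪ C₂) - u is independent; extend it to a
-- basis B and pick w ∈ C₁ ∖ C₂. Forward chaining from B - w derives u through C₂ and then w
-- through C₁, so B - w is a key: B is a basis but not a minimal key, and a hyperplane containing
-- B - w contains a key without being V, so it is not a true set.

module Submission where

open import Defs hiding (_─_)
open import Data.Nat using (ℕ)
open import Data.Bool.Properties using (T-≡)
open import Data.Bool using () renaming (_≟_ to _≟ᵇ_)
open import Data.Empty using (⊥-elim)
open import Data.Fin using (Fin; _≟_)
open import Data.Fin.Properties using (any?; all?; ¬∀⟶∃¬)
open import Data.Fin.Subset using (⁅_⁆; _∉_; _⊈_; _⊂_; _⊃_; _─_)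
open import Data.Fin.Subset.Properties
open import Data.Fin.Subset.Induction using (Acc; acc; ⊂-wellFounded; ⊃-wellFounded)
open import Data.List using (List; []; _∷_; allFin)
open import Data.List.Membership.Propositional.Properties using (∈-allFin)
import Data.List.Membership.DecPropositional as DecMembership
open import Data.List.Relation.Unary.All as All using (All; []; _∷_)
open import Data.List.Relation.Unary.Any using (here; there)
open import Data.Product using (∃-syntax; _×_; _,_; proj₁; proj₂)
open import Data.Sum as Sum using (_⊎_; inj₁; inj₂)
open import Data.Vec using (_∷_; there; tabulate)
open import Data.Vec.Properties using (≡-dec; lookup∘tabulate; []=⇒lookup; lookup⇒[]=)
open import Function using (_∘_)
open import Function.Bundles using (_⇔_; mk⇔; Equivalence)
open import Relation.Binary.PropositionalEquality using (_≡_; _≢_; refl; sym; trans; subst)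
open import Relation.Nullary using (¬_; Dec; yes; no; contradiction)
open import Relation.Nullary.Decidable
  using (decidable-stable; isYes; fromWitness; toWitness; ¬?; _×-dec_; _⊎-dec_; _→-dec_)

private variable
  n : ℕ
  x y z : Fin n
  p q r X : Subset n
  𝓕 𝓖 𝓗 : Family n

infixl 6 _∪⁅_⁆

_∪⁅_⁆ : Subset n → Fin n → Subset n
p ∪⁅ y ⁆ = p ∪ ⁅ y ⁆

x∈p∪⁅y⁆⁻ : x ∈ p ∪⁅ y ⁆ → x ∈ p ⊎ x ≡ y
x∈p∪⁅y⁆⁻ {p = p} {y = y} = Sum.map₂ (x∈⁅y⁆⇒x≡y y) ∘ x∈p∪q⁻ p ⁅ y ⁆

x∈p⇒x∈p∪⁅y⁆ : x ∈ p → x ∈ p ∪⁅ y ⁆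
x∈p⇒x∈p∪⁅y⁆ = x∈p∪q⁺ ∘ inj₁

y∈p∪⁅y⁆ : y ∈ p ∪⁅ y ⁆
y∈p∪⁅y⁆ {y = y} = x∈p∪q⁺ (inj₂ (x∈⁅x⁆ y))

∪⁅⁆-lub : p ⊆ q → y ∈ q → p ∪⁅ y ⁆ ⊆ q
∪⁅⁆-lub p⊆q y∈q x∈ with x∈p∪⁅y⁆⁻ x∈
... | inj₁ x∈p = p⊆q x∈p
... | inj₂ refl = y∈q

∪⁅⁆-mono : p ⊆ q → p ∪⁅ y ⁆ ⊆ q ∪⁅ y ⁆
∪⁅⁆-mono p⊆q = ∪⁅⁆-lub (x∈p⇒x∈p∪⁅y⁆ ∘ p⊆q) y∈p∪⁅y⁆

∪-lub : p ⊆ r → q ⊆ r → p ∪ q ⊆ r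
∪-lub {p = p} {q = q} p⊆r q⊆r x∈ with x∈p∪q⁻ p q x∈
... | inj₁ x∈p = p⊆r x∈p
... | inj₂ x∈q = q⊆r x∈q

x∉p∪q : x ∉ p → x ∉ q → x ∉ p ∪ q
x∉p∪q {p = p} {q = q} x∉p x∉q x∈ with x∈p∪q⁻ p q x∈
... | inj₁ x∈p = x∉p x∈p
... | inj₂ x∈q = x∉q x∈q

x∈p─q⇒x∉q : x ∈ p ─ q → x ∉ q
x∈p─q⇒x∉q {p = _ ∷ _} {q = _ ∷ _} (there x∈) (there x∈q) = x∈p─q⇒x∉q x∈ x∈q

x∈p-y⇒x∈p : x ∈ p - y → x ∈ p
x∈p-y⇒x∈p {p = p} {y = y} = p─q⊆p p ⁅ y ⁆

x∈p-y⇒x≢y : x ∈ p - y → x ≢ y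
x∈p-y⇒x≢y x∈ refl = x∈p─q⇒x∉q x∈ (x∈⁅x⁆ _)

p⊆p-y∪⁅y⁆ : ∀ {n} {p : Subset n} {y} → p ⊆ (p - y) ∪⁅ y ⁆
p⊆p-y∪⁅y⁆ {y = y} {x} x∈p with x ≟ y
... | yes refl = y∈p∪⁅y⁆
... | no x≢y = x∈p⇒x∈p∪⁅y⁆ (x∈p∧x≢y⇒x∈p-y x∈p x≢y)

-‿mono : p ⊆ q → p - y ⊆ q - y
-‿mono p⊆q x∈ = x∈p∧x≢y⇒x∈p-y (p⊆q (x∈p-y⇒x∈p x∈)) (x∈p-y⇒x≢y x∈)

⊈-witness : p ⊈ q → ∃[ x ] (x ∈ p × x ∉ q)
⊈-witness {p = p} {q = q} p⊈q
  with ¬∀⟶∃¬ _ (λ x → x ∈ p → x ∈ q) (λ x → x ∈? p →-dec x ∈? q) (λ p⊆q → p⊈q (p⊆q _))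
... | x , ¬[x∈p⇒x∈q] with x ∈? p
...   | yes x∈p = x , x∈p , λ x∈q → ¬[x∈p⇒x∈q] (λ _ → x∈q)
...   | no x∉p = contradiction (λ x∈p → contradiction x∈p x∉p) ¬[x∈p⇒x∈q]

∪-⊂ : p ⊆ r → q ⊆ r → x ∈ r → x ∉ p → x ∉ q → p ∪ q ⊂ r
∪-⊂ p⊆r q⊆r x∈r x∉p x∉q = ∪-lub p⊆r q⊆r , _ , x∈r , x∉p∪q x∉p x∉q

fromDec : {P : Fin n → Set} → (∀ x → Dec (P x)) → Subset n
fromDec P? = tabulate (isYes ∘ P?)

module _ {P : Fin n → Set} (P? : ∀ x → Dec (P x)) where

  ∈-fromDec⁺ : P x → x ∈ fromDec P?
  ∈-fromDec⁺ {x = x} Px =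
    lookup⇒[]= x _ (trans (lookup∘tabulate _ x) (Equivalence.to T-≡ (fromWitness Px)))

  ∈-fromDec⁻ : x ∈ fromDec P? → P x
  ∈-fromDec⁻ {x = x} x∈ =
    toWitness {a? = P? x} (Equivalence.from T-≡ (trans (sym (lookup∘tabulate _ x)) ([]=⇒lookup x∈)))

extendToMaximal : {P : Subset n → Set} → (∀ X → Dec (P X)) → P X →
                  ∃[ Y ] (X ⊆ Y × P Y × (∀ z → z ∉ Y → ¬ P (Y ∪⁅ z ⁆)))
extendToMaximal {P = P} P? = go (⊃-wellFounded _)
  where
  go : Acc _⊃_ X → P X → ∃[ Y ] (X ⊆ Y × P Y × (∀ z → z ∉ Y → ¬ P (Y ∪⁅ z ⁆)))
  go {X = X} (acc rec) PX with any? (λ z → ¬? (z ∈? X) ×-dec P? (X ∪⁅ z ⁆))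
  ... | no stuck = X , ⊆-refl , PX , λ z z∉X PX∪z → stuck (z , z∉X , PX∪z)
  ... | yes (z , z∉X , PX∪z) with go (rec (x∈p⇒x∈p∪⁅y⁆ , z , y∈p∪⁅y⁆ , z∉X)) PX∪z
  ...   | Y , X∪z⊆Y , PY , maximal = Y , X∪z⊆Y ∘ x∈p⇒x∈p∪⁅y⁆ , PY , maximal

≐-sym : 𝓕 ≐ 𝓖 → 𝓖 ≐ 𝓕
≐-sym 𝓕≐𝓖 X = proj₂ (𝓕≐𝓖 X) , proj₁ (𝓕≐𝓖 X)

≐-trans : 𝓕 ≐ 𝓖 → 𝓖 ≐ 𝓗 → 𝓕 ≐ 𝓗
≐-trans 𝓕≐𝓖 𝓖≐𝓗 X = proj₁ (𝓖≐𝓗 X) ∘ proj₁ (𝓕≐𝓖 X) , proj₂ (𝓕≐𝓖 X) ∘ proj₂ (𝓖≐𝓗 X)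

transversal-⊇ : (∀ G → 𝓖 G → 𝓕 G) → Transversal 𝓕 X → Transversal 𝓖 X
transversal-⊇ 𝓖⊆𝓕 t G 𝓖G = t G (𝓖⊆𝓕 G 𝓖G)

ᵈ-cong : 𝓕 ≐ 𝓖 → (𝓕 ᵈ) ≐ (𝓖 ᵈ)
ᵈ-cong 𝓕≐𝓖 X = ᵈ-mono 𝓕≐𝓖 , ᵈ-mono (≐-sym 𝓕≐𝓖)
  where
  ᵈ-mono : 𝓕 ≐ 𝓖 → (𝓕 ᵈ) X → (𝓖 ᵈ) X
  ᵈ-mono 𝓕≐𝓖 (t , minimal) =
      transversal-⊇ (λ F → proj₂ (𝓕≐𝓖 F)) t
    , λ Y Y⊆X tY → minimal Y Y⊆X (transversal-⊇ (λ F → proj₁ (𝓕≐𝓖 F)) tY)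

ᵈᶜ-cong : 𝓕 ≐ 𝓖 → ((𝓕 ᵈ) ᶜ) ≐ ((𝓖 ᵈ) ᶜ)
ᵈᶜ-cong 𝓕≐𝓖 X = ᵈ-cong 𝓕≐𝓖 (∁ X)

^∩-cong : 𝓕 ≐ 𝓖 → (𝓕 ^∩) ≐ (𝓖 ^∩)
^∩-cong 𝓕≐𝓖 X = ^∩-mono 𝓕≐𝓖 , ^∩-mono (≐-sym 𝓕≐𝓖)
  where
  ^∩-mono : 𝓕 ≐ 𝓖 → (𝓕 ^∩) X → (𝓖 ^∩) X
  ^∩-mono 𝓕≐𝓖 (Fs , 𝓕Fs , X≡⋂Fs) = Fs , All.map (λ {F} → proj₁ (𝓕≐𝓖 F)) 𝓕Fs , X≡⋂Fs

⊆-⋂ : ∀ {Fs} → All (X ⊆_) Fs → X ⊆ ⋂ Fs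
⊆-⋂ [] _ = ∈⊤
⊆-⋂ (X⊆F ∷ X⊆Fs) x∈X = x∈p∩q⁺ (X⊆F x∈X , ⊆-⋂ X⊆Fs x∈X)

separated⇒^∩ : ∀ {n} {X : Subset n} {𝓕 : Family n} →
               (∀ z → z ∉ X → ∃[ F ] (𝓕 F × X ⊆ F × z ∉ F)) → (𝓕 ^∩) X
separated⇒^∩ {n} {X} {𝓕} separate with separateAll (allFin n)
  where
  separateAll : (zs : List (Fin n)) →
    ∃[ Fs ] (All 𝓕 Fs × All (X ⊆_) Fs × (∀ z → z ∈ᴸ zs → z ∉ X → z ∉ ⋂ Fs))
  separateAll [] = [] , [] , [] , λ _ ()
  separateAll (y ∷ zs) with separateAll zs | y ∈? X
  ... | Fs , 𝓕Fs , X⊆Fs , avoids | yes y∈X =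
    Fs , 𝓕Fs , X⊆Fs , λ
    { _ (here refl) y∉X → contradiction y∈X y∉X
    ; z (there z∈zs) → avoids z z∈zs }
  ... | Fs , 𝓕Fs , X⊆Fs , avoids | no y∉X with separate y y∉X
  ...   | F , 𝓕F , X⊆F , y∉F = F ∷ Fs , 𝓕F ∷ 𝓕Fs , X⊆F ∷ X⊆Fs , λ
    { _ (here refl) _ y∈ → y∉F (proj₁ (x∈p∩q⁻ F _ y∈))
    ; z (there z∈zs) z∉X z∈ → avoids z z∈zs z∉X (proj₂ (x∈p∩q⁻ F _ z∈)) }
... | Fs , 𝓕Fs , X⊆Fs , avoids = Fs , 𝓕Fs , ⊆-antisym (⊆-⋂ X⊆Fs) ⋂Fs⊆X
  where
  ⋂Fs⊆X : ⋂ Fs ⊆ X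
  ⋂Fs⊆X {x} x∈ with x ∈? X
  ... | yes x∈X = x∈X
  ... | no x∉X = contradiction x∈ (avoids x (∈-allFin x) x∉X)

Contains : Family n → Subset n → Set
Contains 𝓕 X = ∃[ F ] (𝓕 F × F ⊆ X)

contains-⊆ : p ⊆ q → Contains 𝓕 p → Contains 𝓕 q
contains-⊆ p⊆q (F , 𝓕F , F⊆p) = F , 𝓕F , p⊆q ∘ F⊆p

contains? : (∀ F → Dec (𝓕 F)) → ∀ X → Dec (Contains 𝓕 X)
contains? 𝓕? X = anySubset? (λ F → 𝓕? F ×-dec F ⊆? X)

MaximalFree : Family n → Family n
MaximalFree 𝓕 X = ¬ Contains 𝓕 X × (∀ z → z ∉ X → Contains 𝓕 (X ∪⁅ z ⁆))

maximalFree? : (∀ X → Dec (Contains 𝓕 X)) → ∀ X → Dec (MaximalFree 𝓕 X)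
maximalFree? contains𝓕? X =
  ¬? (contains𝓕? X) ×-dec all? (λ z → ¬? (z ∈? X) →-dec contains𝓕? (X ∪⁅ z ⁆))

maximalFree⇒ᵈᶜ : MaximalFree 𝓕 X → ((𝓕 ᵈ) ᶜ) X
maximalFree⇒ᵈᶜ {𝓕 = 𝓕} {X = X} (free , maximal) = transversal , minimal
  where
  transversal : Transversal 𝓕 (∁ X)
  transversal F 𝓕F with ⊈-witness (λ F⊆X → free (F , 𝓕F , F⊆X))
  ... | x , x∈F , x∉X = x , x∉p⇒x∈∁p x∉X , x∈F
  minimal : ∀ Y → Y ⊆ ∁ X → Transversal 𝓕 Y → ∁ X ⊆ Y
  minimal Y Y⊆∁X tY {x} x∈∁X with x ∈? Y
  ... | yes x∈Y = x∈Y
  ... | no x∉Y with maximal x (x∈∁p⇒x∉p x∈∁X)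
  ...   | F , 𝓕F , F⊆X∪x with tY F 𝓕F
  ...     | y , y∈Y , y∈F with x∈p∪⁅y⁆⁻ (F⊆X∪x y∈F)
  ...       | inj₁ y∈X = contradiction y∈X (x∈∁p⇒x∉p (Y⊆∁X y∈Y))
  ...       | inj₂ refl = contradiction y∈Y x∉Y

ᵈᶜ⇒maximalFree : (∀ Y → Dec (Contains 𝓕 Y)) → ((𝓕 ᵈ) ᶜ) X → MaximalFree 𝓕 X
ᵈᶜ⇒maximalFree {𝓕 = 𝓕} {X = X} contains𝓕? (t , minimal) = free , maximal
  where
  free : ¬ Contains 𝓕 X
  free (F , 𝓕F , F⊆X) with t F 𝓕F
  ... | x , x∈∁X , x∈F = x∈∁p⇒x∉p x∈∁X (F⊆X x∈F)
  maximal : ∀ z → z ∉ X → Contains 𝓕 (X ∪⁅ z ⁆)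
  maximal z z∉X = decidable-stable (contains𝓕? (X ∪⁅ z ⁆)) λ free′ →
    x∈p-y⇒x≢y (minimal (∁ X - z) x∈p-y⇒x∈p (t′ free′) (x∉p⇒x∈∁p z∉X)) refl
    where
    t′ : ¬ Contains 𝓕 (X ∪⁅ z ⁆) → Transversal 𝓕 (∁ X - z)
    t′ free′ F 𝓕F with ⊈-witness (λ F⊆X∪z → free′ (F , 𝓕F , F⊆X∪z))
    ... | x , x∈F , x∉X∪z =
      x , x∈p∧x≢y⇒x∈p-y (x∉p⇒x∈∁p (x∉X∪z ∘ x∈p⇒x∈p∪⁅y⁆)) (λ { refl → x∉X∪z y∈p∪⁅y⁆ }) , x∈F

maximalFree≐ᵈᶜ : (∀ Y → Dec (Contains 𝓕 Y)) → MaximalFree 𝓕 ≐ ((𝓕 ᵈ) ᶜ)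
maximalFree≐ᵈᶜ contains𝓕? X = maximalFree⇒ᵈᶜ , ᵈᶜ⇒maximalFree contains𝓕?

⊤-true : TrueSet 𝓗 ⊤
⊤-true _ _ _ _ _ = ∈⊤

∩-true : TrueSet 𝓗 p → TrueSet 𝓗 q → TrueSet 𝓗 (p ∩ q)
∩-true {p = p} {q = q} tp tq H 𝓗H v v∈H H-v⊆p∩q = x∈p∩q⁺
  (tp H 𝓗H v v∈H (proj₁ ∘ x∈p∩q⁻ p q ∘ H-v⊆p∩q) , tq H 𝓗H v v∈H (proj₂ ∘ x∈p∩q⁻ p q ∘ H-v⊆p∩q))

⋂-true : ∀ {Ts} → All (TrueSet 𝓗) Ts → TrueSet 𝓗 (⋂ Ts)
⋂-true [] = ⊤-true
⋂-true (tT ∷ tTs) = ∩-true tT (⋂-true tTs)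

isKey-⊆ : IsKey 𝓗 p → p ⊆ q → IsKey 𝓗 q
isKey-⊆ key p⊆q v T tT q⊆T = key v T tT (q⊆T ∘ p⊆q)

isKey-⊆-true⇒≡⊤ : IsKey 𝓗 p → TrueSet 𝓗 q → p ⊆ q → q ≡ ⊤
isKey-⊆-true⇒≡⊤ key tq p⊆q = ⊆-antisym ⊆⊤ (λ {v} _ → key v _ tq p⊆q)

-- Circuits, bases and hyperplanes

module Circuits {n : ℕ} (L : List (Subset n)) where

  private
    𝓒 : Family n
    𝓒 = listFam L
    module ∈ᴸ = DecMembership {A = Subset n} (≡-dec _≟ᵇ_)
    variable
      B I J K T : Subset n

  Dependent : Subset n → Set
  Dependent = Contains 𝓒

  Independent : Subset n → Set
  Independent X = ¬ Dependent X

  dependent? : ∀ X → Dec (Dependent X)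
  dependent? = contains? (∈ᴸ._∈? L)

  independent-⊆ : p ⊆ q → Independent q → Independent p
  independent-⊆ p⊆q indq = indq ∘ contains-⊆ p⊆q

  ⊥-independent : ¬ 𝓒 ⊥ → Independent ⊥
  ⊥-independent ⊥∉𝓒 (C , C∈L , C⊆⊥) = ⊥∉𝓒 (subst 𝓒 (⊆-antisym C⊆⊥ ⊥⊆) C∈L)

  CircuitThrough : Fin n → Subset n → Set
  CircuitThrough x U = ∃[ C ] (C ∈ᴸ L × C ⊆ U × x ∈ C)

  circuitThrough-⊆ : p ⊆ q → CircuitThrough x p → CircuitThrough x q
  circuitThrough-⊆ p⊆q (C , C∈L , C⊆p , x∈C) = C , C∈L , p⊆q ∘ C⊆p , x∈C

  fundamentalCircuit : Independent I → Dependent (I ∪⁅ x ⁆) → CircuitThrough x (I ∪⁅ x ⁆)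
  fundamentalCircuit {I} {x} indI (C , C∈L , C⊆I∪x) with x ∈? C
  ... | yes x∈C = C , C∈L , C⊆I∪x , x∈C
  ... | no x∉C = ⊥-elim (indI (C , C∈L , C⊆I))
    where
    C⊆I : C ⊆ I
    C⊆I y∈C with x∈p∪⁅y⁆⁻ (C⊆I∪x y∈C)
    ... | inj₁ y∈I = y∈I
    ... | inj₂ refl = contradiction y∈C x∉C

  distinctCircuits-⊈ : Sperner 𝓒 → ∀ {C D} → C ∈ᴸ L → D ∈ᴸ L → C ≢ D → C ⊈ D
  distinctCircuits-⊈ sperner C∈L D∈L C≢D C⊆D = C≢D (sperner _ _ C∈L D∈L C⊆D)

  Basis : Family n
  Basis = MaximalFree 𝓒

  HasBasis : Subset n → Set
  HasBasis = Contains Basis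

  hasBasis? : ∀ X → Dec (HasBasis X)
  hasBasis? = contains? (maximalFree? dependent?)

  Hyperplane : Family n
  Hyperplane = MaximalFree Basis

  basis≐ᵈᶜ : Basis ≐ ((𝓒 ᵈ) ᶜ)
  basis≐ᵈᶜ = maximalFree≐ᵈᶜ dependent?

  hyperplane≐ᵈᶜᵈᶜ : Hyperplane ≐ ((((𝓒 ᵈ) ᶜ) ᵈ) ᶜ)
  hyperplane≐ᵈᶜᵈᶜ = ≐-trans (maximalFree≐ᵈᶜ hasBasis?) (ᵈᶜ-cong basis≐ᵈᶜ)

  extendToBasis : Independent I → ∃[ B ] (I ⊆ B × Basis B)
  extendToBasis indI with extendToMaximal (¬? ∘ dependent?) indI
  ... | B , I⊆B , indB , maximal =
    B , I⊆B , indB , λ z z∉B → decidable-stable (dependent? _) (maximal z z∉B)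

  extendToHyperplane : ¬ HasBasis X → ∃[ H ] (X ⊆ H × Hyperplane H)
  extendToHyperplane noBasis with extendToMaximal (¬? ∘ hasBasis?) noBasis
  ... | H , X⊆H , noBasisH , maximal =
    H , X⊆H , noBasisH , λ z z∉H → decidable-stable (hasBasis? _) (maximal z z∉H)

  basis⊆independent⇒⊇ : Basis B → Independent I → B ⊆ I → I ⊆ B
  basis⊆independent⇒⊇ {B} (_ , maximal) indI B⊆I {x} x∈I with x ∈? B
  ... | yes x∈B = x∈B
  ... | no x∉B = contradiction (maximal x x∉B) (independent-⊆ (∪⁅⁆-lub B⊆I x∈I) indI)

  -- Opaque because unfolding the decision procedures inside span makes type checking explode.
  opaque
    span : Subset n → Subset n
    span I = fromDec (λ x → x ∈? I ⊎-dec dependent? (I ∪⁅ x ⁆))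

    ⊆-span : I ⊆ span I
    ⊆-span x∈I = ∈-fromDec⁺ _ (inj₁ x∈I)

    dependent⇒∈span : Dependent (I ∪⁅ x ⁆) → x ∈ span I
    dependent⇒∈span dep = ∈-fromDec⁺ _ (inj₂ dep)

    ∈span⇒dependent : x ∈ span I → x ∉ I → Dependent (I ∪⁅ x ⁆)
    ∈span⇒dependent x∈ x∉I with ∈-fromDec⁻ _ x∈
    ... | inj₁ x∈I = contradiction x∈I x∉I
    ... | inj₂ dep = dep

  ∉span⇒independent : x ∉ span I → Independent (I ∪⁅ x ⁆)
  ∉span⇒independent x∉ = x∉ ∘ dependent⇒∈span

  span-mono : I ⊆ J → span I ⊆ span J
  span-mono {I} I⊆J {x} x∈ with x ∈? I
  ... | yes x∈I = ⊆-span (I⊆J x∈I)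
  ... | no x∉I = dependent⇒∈span (contains-⊆ (∪⁅⁆-mono I⊆J) (∈span⇒dependent x∈ x∉I))

  maximalIndependentSubset : ¬ 𝓒 ⊥ → ∀ X → ∃[ I ] (I ⊆ X × Independent I × X ⊆ span I)
  maximalIndependentSubset ⊥∉𝓒 X
    with extendToMaximal (λ I → ¬? (dependent? I) ×-dec I ⊆? X) (⊥-independent ⊥∉𝓒 , ⊥⊆)
  ... | I , _ , (indI , I⊆X) , maximal = I , I⊆X , indI , X⊆span
    where
    X⊆span : X ⊆ span I
    X⊆span {x} x∈X with x ∈? I
    ... | yes x∈I = ⊆-span x∈I
    ... | no x∉I = dependent⇒∈span
      (decidable-stable (dependent? _) λ ind → maximal x x∉I (ind , ∪⁅⁆-lub I⊆X x∈X))

  dependent⇒∈true : Independent I → Dependent (I ∪⁅ x ⁆) → TrueSet 𝓒 T → I ⊆ T → x ∈ T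
  dependent⇒∈true {I} {x} {T} indI dep tT I⊆T with fundamentalCircuit indI dep
  ... | C , C∈L , C⊆I∪x , x∈C = tT C C∈L x x∈C C-x⊆T
    where
    C-x⊆T : C - x ⊆ T
    C-x⊆T y∈ with x∈p∪⁅y⁆⁻ (C⊆I∪x (x∈p-y⇒x∈p y∈))
    ... | inj₁ y∈I = I⊆T y∈I
    ... | inj₂ refl = contradiction refl (x∈p-y⇒x≢y y∈)

  span⊆true : Independent I → TrueSet 𝓒 T → I ⊆ T → span I ⊆ T
  span⊆true {I} indI tT I⊆T {x} x∈ with x ∈? I
  ... | yes x∈I = I⊆T x∈I
  ... | no x∉I = dependent⇒∈true indI (∈span⇒dependent x∈ x∉I) tT I⊆T

  spanning⇒isKey : Independent I → K ⊆ span I → IsKey 𝓒 K → IsKey 𝓒 I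
  spanning⇒isKey indI K⊆span key v T tT I⊆T = key v T tT (span⊆true indI tT I⊆T ∘ K⊆span)

  basis⇒isKey : Basis B → IsKey 𝓒 B
  basis⇒isKey {B} (indB , maximal) v T tT B⊆T with v ∈? B
  ... | yes v∈B = B⊆T v∈B
  ... | no v∉B = dependent⇒∈true indB (maximal v v∉B) tT B⊆T

  hasBasis⇒isKey : HasBasis K → IsKey 𝓒 K
  hasBasis⇒isKey (B , basisB , B⊆K) = isKey-⊆ (basis⇒isKey basisB) B⊆K

  ¬hasBasis⇒≢⊤ : ¬ 𝓒 ⊥ → ¬ HasBasis X → X ≢ ⊤
  ¬hasBasis⇒≢⊤ ⊥∉𝓒 noBasis refl with extendToBasis (⊥-independent ⊥∉𝓒)
  ... | B , _ , basisB = noBasis (B , basisB , ⊆⊤)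

  basis-remove-¬hasBasis : Basis B → x ∈ B → ¬ HasBasis (B - x)
  basis-remove-¬hasBasis basisB x∈B (B′ , basisB′ , B′⊆B-x) =
    x∈p-y⇒x≢y (B′⊆B-x (basis⊆independent⇒⊇ basisB′ (proj₁ basisB) (x∈p-y⇒x∈p ∘ B′⊆B-x) x∈B)) refl

  exchange-isKey : Basis B → y ∉ B - z → Independent ((B - z) ∪⁅ y ⁆) → IsKey 𝓒 ((B - z) ∪⁅ y ⁆)
  exchange-isKey {B} {y} {z} basisB y∉B-z indJ∪y v T tT J∪y⊆T = basis⇒isKey basisB v T tT B⊆T
    where
    z∈T : z ∈ T
    z∈T with y ≟ z
    ... | yes refl = J∪y⊆T y∈p∪⁅y⁆
    ... | no y≢z = dependent⇒∈true indJ∪y (contains-⊆ B∪y⊆ (proj₂ basisB y y∉B)) tT J∪y⊆T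
      where
      y∉B : y ∉ B
      y∉B y∈B = y∉B-z (x∈p∧x≢y⇒x∈p-y y∈B y≢z)
      B∪y⊆ : B ∪⁅ y ⁆ ⊆ (B - z) ∪⁅ y ⁆ ∪⁅ z ⁆
      B∪y⊆ = ∪⁅⁆-lub (∪⁅⁆-mono x∈p⇒x∈p∪⁅y⁆ ∘ p⊆p-y∪⁅y⁆) (x∈p⇒x∈p∪⁅y⁆ y∈p∪⁅y⁆)
    B⊆T : B ⊆ T
    B⊆T = ∪⁅⁆-lub (J∪y⊆T ∘ x∈p⇒x∈p∪⁅y⁆) z∈T ∘ p⊆p-y∪⁅y⁆

  -- Failure of the circuit axiom

  record CircuitAxiomFailure : Set where
    constructor failure
    field
      C₁ C₂ : Subset n
      C₁∈L : C₁ ∈ᴸ L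
      C₂∈L : C₂ ∈ᴸ L
      C₁≢C₂ : C₁ ≢ C₂
      u : Fin n
      u∈C₁ : u ∈ C₁
      u∈C₂ : u ∈ C₂
      eliminationIndependent : Independent ((C₁ ∪ C₂) - u)

  ¬failure⇒circuitAxiom : ¬ CircuitAxiomFailure → CircuitAxiom 𝓒
  ¬failure⇒circuitAxiom noFailure C₁ C₂ C₁∈L C₂∈L C₁≢C₂ u u∈C₁ u∈C₂ =
    decidable-stable (dependent? _) (noFailure ∘ failure C₁ C₂ C₁∈L C₂∈L C₁≢C₂ u u∈C₁ u∈C₂)

  failure⇒basis-isKey-remove : Sperner 𝓒 → CircuitAxiomFailure →
                               ∃[ B ] ∃[ w ] (Basis B × w ∈ B × IsKey 𝓒 (B - w))
  failure⇒basis-isKey-remove sperner (failure C₁ C₂ C₁∈L C₂∈L C₁≢C₂ u u∈C₁ u∈C₂ indS)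
    with ⊈-witness (distinctCircuits-⊈ sperner C₁∈L C₂∈L C₁≢C₂) | extendToBasis indS
  ... | w , w∈C₁ , w∉C₂ | B , S⊆B , basisB = B , w , basisB , S⊆B w∈S , isKey
    where
    w∈S : w ∈ (C₁ ∪ C₂) - u
    w∈S = x∈p∧x≢y⇒x∈p-y (x∈p∪q⁺ (inj₁ w∈C₁)) λ { refl → w∉C₂ u∈C₂ }
    isKey : IsKey 𝓒 (B - w)
    isKey v T tT B-w⊆T = basis⇒isKey basisB v T tT (∪⁅⁆-lub B-w⊆T w∈T ∘ p⊆p-y∪⁅y⁆)
      where
      S-w⊆T : (C₁ ∪ C₂) - u - w ⊆ T
      S-w⊆T = B-w⊆T ∘ -‿mono S⊆B
      u∈T : u ∈ T
      u∈T = tT C₂ C₂∈L u u∈C₂ λ x∈ →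
        S-w⊆T (x∈p∧x≢y⇒x∈p-y (-‿mono (x∈p∪q⁺ ∘ inj₂) x∈) λ { refl → w∉C₂ (x∈p-y⇒x∈p x∈) })
      C₁-w⊆T : C₁ - w ⊆ T
      C₁-w⊆T {x} x∈ with x ≟ u
      ... | yes refl = u∈T
      ... | no x≢u = S-w⊆T (x∈p∧x≢y⇒x∈p-y
                       (x∈p∧x≢y⇒x∈p-y (x∈p∪q⁺ (inj₁ (x∈p-y⇒x∈p x∈))) x≢u) (x∈p-y⇒x≢y x∈))
      w∈T : w ∈ T
      w∈T = tT C₁ C₁∈L w w∈C₁ C₁-w⊆T

  failure⇒¬minKey : Sperner 𝓒 → CircuitAxiomFailure → ∃[ B ] (Basis B × ¬ MinKeys 𝓒 B)
  failure⇒¬minKey sperner fail with failure⇒basis-isKey-remove sperner fail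
  ... | B , w , basisB , w∈B , isKey =
    B , basisB , λ (_ , minimal) → x∈p-y⇒x≢y (minimal (B - w) x∈p-y⇒x∈p isKey w∈B) refl

  failure⇒¬trueHyperplane : Sperner 𝓒 → CircuitAxiomFailure → ∃[ H ] (Hyperplane H × ¬ TrueSet 𝓒 H)
  failure⇒¬trueHyperplane sperner fail with failure⇒basis-isKey-remove sperner fail
  ... | B , w , basisB , w∈B , isKey with extendToHyperplane (basis-remove-¬hasBasis basisB w∈B)
  ...   | H , B-w⊆H , hyperplaneH@(noBasisH , _) = H , hyperplaneH , λ tH →
    noBasisH (B , basisB , λ _ → subst (_ ∈_) (sym (isKey-⊆-true⇒≡⊤ isKey tH B-w⊆H)) ∈⊤)

  module Matroid (sperner : Sperner 𝓒) (⊥∉𝓒 : ¬ 𝓒 ⊥) (c3 : CircuitAxiom 𝓒) where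

    -- By induction on C₁ ∪ C₂: if the circuit C₃ given by (C3) misses f, eliminate some
    -- g ∈ C₃ ∖ C₁ from C₂ and C₃ keeping e, then e from C₁ and the circuit obtained.
    strongElimination : ∀ {C₁ C₂ e f} → C₁ ∈ᴸ L → C₂ ∈ᴸ L → e ∈ C₁ → e ∈ C₂ → f ∈ C₁ → f ∉ C₂ →
                        CircuitThrough f ((C₁ ∪ C₂) - e)
    strongElimination = go (⊂-wellFounded _)
      where
      go : ∀ {C₁ C₂ e f} → Acc _⊂_ (C₁ ∪ C₂) →
           C₁ ∈ᴸ L → C₂ ∈ᴸ L → e ∈ C₁ → e ∈ C₂ → f ∈ C₁ → f ∉ C₂ → CircuitThrough f ((C₁ ∪ C₂) - e)
      go {C₁} {C₂} {e} {f} (acc smaller) C₁∈L C₂∈L e∈C₁ e∈C₂ f∈C₁ f∉C₂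
        with c3 C₁ C₂ C₁∈L C₂∈L (λ { refl → f∉C₂ f∈C₁ }) e e∈C₁ e∈C₂
      ... | C₃ , C₃∈L , C₃⊆ with f ∈? C₃
      ...   | yes f∈C₃ = C₃ , C₃∈L , C₃⊆ , f∈C₃
      ...   | no f∉C₃
        with ⊈-witness (distinctCircuits-⊈ sperner C₃∈L C₁∈L λ { refl → x∈p-y⇒x≢y (C₃⊆ e∈C₁) refl })
      ...     | g , g∈C₃ , g∉C₁ = useC₄ (go (smaller C₂∪C₃⊂C₁∪C₂) C₂∈L C₃∈L g∈C₂ g∈C₃ e∈C₂ e∉C₃)
        where
        C₃⊆C₁∪C₂ : C₃ ⊆ C₁ ∪ C₂
        C₃⊆C₁∪C₂ = x∈p-y⇒x∈p ∘ C₃⊆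
        e∉C₃ : e ∉ C₃
        e∉C₃ e∈C₃ = x∈p-y⇒x≢y (C₃⊆ e∈C₃) refl
        g∈C₂ : g ∈ C₂
        g∈C₂ with x∈p∪q⁻ C₁ C₂ (C₃⊆C₁∪C₂ g∈C₃)
        ... | inj₁ g∈C₁ = contradiction g∈C₁ g∉C₁
        ... | inj₂ g∈C₂ = g∈C₂
        C₂∪C₃⊂C₁∪C₂ : C₂ ∪ C₃ ⊂ C₁ ∪ C₂
        C₂∪C₃⊂C₁∪C₂ = ∪-⊂ (x∈p∪q⁺ ∘ inj₂) C₃⊆C₁∪C₂ (x∈p∪q⁺ (inj₁ f∈C₁)) f∉C₂ f∉C₃
        useC₄ : CircuitThrough e ((C₂ ∪ C₃) - g) → CircuitThrough f ((C₁ ∪ C₂) - e)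
        useC₄ (C₄ , C₄∈L , C₄⊆ , e∈C₄) =
          circuitThrough-⊆ (-‿mono (∪-lub (x∈p∪q⁺ ∘ inj₁) C₄⊆C₁∪C₂))
            (go (smaller C₁∪C₄⊂C₁∪C₂) C₁∈L C₄∈L e∈C₁ e∈C₄ f∈C₁ f∉C₄)
          where
          C₄⊆C₁∪C₂ : C₄ ⊆ C₁ ∪ C₂
          C₄⊆C₁∪C₂ = proj₁ C₂∪C₃⊂C₁∪C₂ ∘ x∈p-y⇒x∈p ∘ C₄⊆
          f∉C₄ : f ∉ C₄
          f∉C₄ = x∉p∪q f∉C₂ f∉C₃ ∘ x∈p-y⇒x∈p ∘ C₄⊆
          C₁∪C₄⊂C₁∪C₂ : C₁ ∪ C₄ ⊂ C₁ ∪ C₂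
          C₁∪C₄⊂C₁∪C₂ = ∪-⊂ (x∈p∪q⁺ ∘ inj₁) C₄⊆C₁∪C₂ (x∈p∪q⁺ (inj₂ g∈C₂)) g∉C₁
                              (λ g∈C₄ → x∈p-y⇒x≢y (C₄⊆ g∈C₄) refl)

    shrinkCircuit : ∀ {C v} → Independent I → v ∉ I → C ∈ᴸ L → v ∈ C → C - v ⊆ span I →
                    x ∈ C → x ∉ I → x ≢ v →
                    ∃[ C′ ] (C′ ∈ᴸ L × v ∈ C′ × C′ - v ⊆ span I × C′ ∪ I ⊂ C ∪ I)
    shrinkCircuit {I} {x} {C} {v} indI v∉I C∈L v∈C C-v⊆span x∈C x∉I x≢v =
      eliminate (fundamentalCircuit indI (∈span⇒dependent (C-v⊆span (x∈p∧x≢y⇒x∈p-y x∈C x≢v)) x∉I))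
      where
      eliminate : CircuitThrough x (I ∪⁅ x ⁆) →
                  ∃[ C′ ] (C′ ∈ᴸ L × v ∈ C′ × C′ - v ⊆ span I × C′ ∪ I ⊂ C ∪ I)
      eliminate (Cx , Cx∈L , Cx⊆I∪x , x∈Cx) = shrink (strongElimination C∈L Cx∈L x∈C x∈Cx v∈C v∉Cx)
        where
        v∉Cx : v ∉ Cx
        v∉Cx v∈Cx with x∈p∪⁅y⁆⁻ (Cx⊆I∪x v∈Cx)
        ... | inj₁ v∈I = v∉I v∈I
        ... | inj₂ refl = x≢v refl
        C∪Cx⊆C∪I : C ∪ Cx ⊆ C ∪ I
        C∪Cx⊆C∪I = ∪-lub (x∈p∪q⁺ ∘ inj₁) (∪⁅⁆-lub (x∈p∪q⁺ ∘ inj₂) (x∈p∪q⁺ (inj₁ x∈C)) ∘ Cx⊆I∪x)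
        shrink : CircuitThrough v ((C ∪ Cx) - x) →
                 ∃[ C′ ] (C′ ∈ᴸ L × v ∈ C′ × C′ - v ⊆ span I × C′ ∪ I ⊂ C ∪ I)
        shrink (C′ , C′∈L , C′⊆ , v∈C′) =
          C′ , C′∈L , v∈C′ , C′-v⊆span ,
          ∪-⊂ (C∪Cx⊆C∪I ∘ x∈p-y⇒x∈p ∘ C′⊆) (x∈p∪q⁺ ∘ inj₂) (x∈p∪q⁺ (inj₁ x∈C))
              (λ x∈C′ → x∈p-y⇒x≢y (C′⊆ x∈C′) refl) x∉I
          where
          C′-v⊆span : C′ - v ⊆ span I
          C′-v⊆span y∈ with x∈p∪q⁻ C Cx (x∈p-y⇒x∈p (C′⊆ (x∈p-y⇒x∈p y∈)))
          ... | inj₁ y∈C = C-v⊆span (x∈p∧x≢y⇒x∈p-y y∈C (x∈p-y⇒x≢y y∈))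
          ... | inj₂ y∈Cx with x∈p∪⁅y⁆⁻ (Cx⊆I∪x y∈Cx)
          ...   | inj₁ y∈I = ⊆-span y∈I
          ...   | inj₂ refl = contradiction refl (x∈p-y⇒x≢y (C′⊆ (x∈p-y⇒x∈p y∈)))

    -- A circuit through v ∉ span I whose other elements lie in span I could be shrunk forever.
    span-true : Independent I → TrueSet 𝓒 (span I)
    span-true {I} indI H H∈L v v∈H H-v⊆span with v ∈? span I
    ... | yes v∈span = v∈span
    ... | no v∉span = ⊥-elim (noCircuitThrough (⊂-wellFounded _) H∈L v∈H H-v⊆span)
      where
      noCircuitThrough : ∀ {C} → Acc _⊂_ (C ∪ I) → C ∈ᴸ L → v ∈ C → ¬ (C - v ⊆ span I)
      noCircuitThrough {C} (acc smaller) C∈L v∈C C-v⊆span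
        with ⊈-witness (λ C⊆I∪v → ∉span⇒independent v∉span (C , C∈L , C⊆I∪v))
      ... | x , x∈C , x∉I∪v
        with shrinkCircuit indI (v∉span ∘ ⊆-span) C∈L v∈C C-v⊆span x∈C
               (x∉I∪v ∘ x∈p⇒x∈p∪⁅y⁆) (λ { refl → x∉I∪v y∈p∪⁅y⁆ })
      ...   | C′ , C′∈L , v∈C′ , C′-v⊆span , C′∪I⊂C∪I =
        noCircuitThrough (smaller C′∪I⊂C∪I) C′∈L v∈C′ C′-v⊆span

    independent-isKey⇒basis : Independent I → IsKey 𝓒 I → Basis I
    independent-isKey⇒basis {I} indI isKey =
      indI , λ z z∉I → ∈span⇒dependent (isKey z (span I) (span-true indI) ⊆-span) z∉I

    isKey⇒hasBasis : IsKey 𝓒 K → HasBasis K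
    isKey⇒hasBasis {K} isKey with maximalIndependentSubset ⊥∉𝓒 K
    ... | I , I⊆K , indI , K⊆span =
      I , independent-isKey⇒basis indI (spanning⇒isKey indI K⊆span isKey) , I⊆K

    minKeys≐basis : MinKeys 𝓒 ≐ Basis
    minKeys≐basis K = minKey⇒basis , basis⇒minKey
      where
      minKey⇒basis : MinKeys 𝓒 K → Basis K
      minKey⇒basis (isKey , minimal) with isKey⇒hasBasis isKey
      ... | B , basisB , B⊆K =
        subst Basis (⊆-antisym B⊆K (minimal B B⊆K (basis⇒isKey basisB))) basisB
      basis⇒minKey : Basis K → MinKeys 𝓒 K
      basis⇒minKey basisK = basis⇒isKey basisK , λ K′ K′⊆K isKey′ →
        let B , basisB , B⊆K′ = isKey⇒hasBasis isKey′
        in B⊆K′ ∘ basis⊆independent⇒⊇ basisB (proj₁ basisK) (K′⊆K ∘ B⊆K′)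

    hyperplane⇒true : Hyperplane X → TrueSet 𝓒 X
    hyperplane⇒true {X} (noBasis , maximal) with maximalIndependentSubset ⊥∉𝓒 X
    ... | I , I⊆X , indI , X⊆span = subst (TrueSet 𝓒) (⊆-antisym span⊆X X⊆span) (span-true indI)
      where
      span⊆X : span I ⊆ X
      span⊆X {y} y∈span with y ∈? X
      ... | yes y∈X = y∈X
      ... | no y∉X = ⊥-elim (noBasis (I , independent-isKey⇒basis indI isKey , I⊆X))
        where
        isKey : IsKey 𝓒 I
        isKey = spanning⇒isKey indI (∪⁅⁆-lub X⊆span y∈span) (hasBasis⇒isKey (maximal y y∉X))

    maxTrue≐hyperplane : MaxTrue 𝓒 ≐ Hyperplane
    maxTrue≐hyperplane T = maxTrue⇒hyperplane , hyperplane⇒maxTrue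
      where
      maxTrue⇒hyperplane : MaxTrue 𝓒 T → Hyperplane T
      maxTrue⇒hyperplane (tT , T≢⊤ , maximal) = noBasis , extends
        where
        noBasis : ¬ HasBasis T
        noBasis hasBasis = T≢⊤ (isKey-⊆-true⇒≡⊤ (hasBasis⇒isKey hasBasis) tT ⊆-refl)
        extends : ∀ z → z ∉ T → HasBasis (T ∪⁅ z ⁆)
        extends z z∉T = decidable-stable (hasBasis? _) λ noBasis′ →
          let H , T∪z⊆H , hyperplaneH = extendToHyperplane noBasis′
          in z∉T (maximal H (hyperplane⇒true hyperplaneH) (¬hasBasis⇒≢⊤ ⊥∉𝓒 (proj₁ hyperplaneH))
                           (T∪z⊆H ∘ x∈p⇒x∈p∪⁅y⁆) (T∪z⊆H y∈p∪⁅y⁆))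
      hyperplane⇒maxTrue : Hyperplane T → MaxTrue 𝓒 T
      hyperplane⇒maxTrue hyperplaneT@(noBasis , extends) =
        hyperplane⇒true hyperplaneT , ¬hasBasis⇒≢⊤ ⊥∉𝓒 noBasis , maximal
        where
        maximal : ∀ T′ → TrueSet 𝓒 T′ → T′ ≢ ⊤ → T ⊆ T′ → T′ ⊆ T
        maximal T′ tT′ T′≢⊤ T⊆T′ {y} y∈T′ with y ∈? T
        ... | yes y∈T = y∈T
        ... | no y∉T = ⊥-elim (T′≢⊤ (isKey-⊆-true⇒≡⊤ (hasBasis⇒isKey (extends y y∉T)) tT′
                                                       (∪⁅⁆-lub T⊆T′ y∈T′)))

    separatingHyperplane : TrueSet 𝓒 T → z ∉ T → ∃[ H ] (Hyperplane H × T ⊆ H × z ∉ H)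
    separatingHyperplane {T} {z} tT z∉T with maximalIndependentSubset ⊥∉𝓒 T
    ... | I , I⊆T , indI , T⊆spanI
      with extendToBasis (λ dep → z∉T (dependent⇒∈true indI dep tT I⊆T))
    ...   | B , I∪z⊆B , basisB = span (B - z) , (noBasis , extends) , T⊆spanJ , z∉spanJ
      where
      indJ : Independent (B - z)
      indJ = independent-⊆ x∈p-y⇒x∈p (proj₁ basisB)
      z∉spanJ : z ∉ span (B - z)
      z∉spanJ z∈ = proj₁ basisB (contains-⊆ (∪⁅⁆-lub x∈p-y⇒x∈p (I∪z⊆B y∈p∪⁅y⁆))
                                             (∈span⇒dependent z∈ λ z∈J → x∈p-y⇒x≢y z∈J refl))
      T⊆spanJ : T ⊆ span (B - z)
      T⊆spanJ = span-mono (λ x∈I → x∈p∧x≢y⇒x∈p-y (I∪z⊆B (x∈p⇒x∈p∪⁅y⁆ x∈I))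
                                                  λ { refl → z∉T (I⊆T x∈I) }) ∘ T⊆spanI
      noBasis : ¬ HasBasis (span (B - z))
      noBasis hasBasis = z∉spanJ
        (subst (z ∈_) (sym (isKey-⊆-true⇒≡⊤ (hasBasis⇒isKey hasBasis) (span-true indJ) ⊆-refl)) ∈⊤)
      extends : ∀ y → y ∉ span (B - z) → HasBasis (span (B - z) ∪⁅ y ⁆)
      extends y y∉spanJ = (B - z) ∪⁅ y ⁆ , basisJ∪y , ∪⁅⁆-mono ⊆-span
        where
        indJ∪y : Independent ((B - z) ∪⁅ y ⁆)
        indJ∪y = ∉span⇒independent y∉spanJ
        basisJ∪y : Basis ((B - z) ∪⁅ y ⁆)
        basisJ∪y = independent-isKey⇒basis indJ∪y (exchange-isKey basisB (y∉spanJ ∘ ⊆-span) indJ∪y)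

    trueSet≐hyperplane^∩ : TrueSet 𝓒 ≐ (Hyperplane ^∩)
    trueSet≐hyperplane^∩ T =
      (λ tT → separated⇒^∩ (λ _ → separatingHyperplane tT)) , intersection⇒true
      where
      intersection⇒true : (Hyperplane ^∩) T → TrueSet 𝓒 T
      intersection⇒true (Hs , hyperplanes , refl) = ⋂-true (All.map hyperplane⇒true hyperplanes)

theorem5 : (n : ℕ) (C : List (Subset n)) →
    let 𝓒 = listFam C in
    Sperner 𝓒 → Nontrivial 𝓒 →
      (CircuitAxiom 𝓒 ⇔ (MinKeys 𝓒 ≐ ((𝓒 ᵈ) ᶜ)))
    × (CircuitAxiom 𝓒 ⇔ (MaxTrue 𝓒 ≐ ((((𝓒 ᵈ) ᶜ) ᵈ) ᶜ)))
    × (CircuitAxiom 𝓒 ⇔ (TrueSet 𝓒 ≐ (((((𝓒 ᵈ) ᶜ) ᵈ) ᶜ) ^∩)))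
theorem5 n L sperner (_ , ⊥∉𝓒) =
    mk⇔ (λ c3 → ≐-trans (minKeys≐basis c3) basis≐ᵈᶜ) ii⇒i
  , mk⇔ (λ c3 → ≐-trans (maxTrue≐hyperplane c3) hyperplane≐ᵈᶜᵈᶜ) iii⇒i
  , mk⇔ (λ c3 → ≐-trans (trueSet≐hyperplane^∩ c3) (^∩-cong hyperplane≐ᵈᶜᵈᶜ)) iv⇒i
  where
  open Circuits L
  open Matroid sperner ⊥∉𝓒

  ii⇒i : MinKeys (listFam L) ≐ ((listFam L ᵈ) ᶜ) → CircuitAxiom (listFam L)
  ii⇒i minKeys≐ = ¬failure⇒circuitAxiom λ fail →
    let B , basisB , ¬minKey = failure⇒¬minKey sperner fail
    in ¬minKey (proj₂ (minKeys≐ B) (proj₁ (basis≐ᵈᶜ B) basisB))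

  iii⇒i : MaxTrue (listFam L) ≐ ((((listFam L ᵈ) ᶜ) ᵈ) ᶜ) → CircuitAxiom (listFam L)
  iii⇒i maxTrue≐ = ¬failure⇒circuitAxiom λ fail →
    let H , hyperplaneH , ¬trueH = failure⇒¬trueHyperplane sperner fail
    in ¬trueH (proj₁ (proj₂ (maxTrue≐ H) (proj₁ (hyperplane≐ᵈᶜᵈᶜ H) hyperplaneH)))

  iv⇒i : TrueSet (listFam L) ≐ (((((listFam L ᵈ) ᶜ) ᵈ) ᶜ) ^∩) → CircuitAxiom (listFam L)
  iv⇒i trueSet≐ = ¬failure⇒circuitAxiom λ fail →
    let H , hyperplaneH , ¬trueH = failure⇒¬trueHyperplane sperner fail
    in ¬trueH (proj₂ (trueSet≐ H)
         (H ∷ [] , proj₁ (hyperplane≐ᵈᶜᵈᶜ H) hyperplaneH ∷ [] , sym (∩-identityʳ H)))
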